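{- Let $P\rhd C\vdash t:T$ and $P'\rhd C'\vdash t':T'$ be derivations (with contexts $C(a),C'(a)$ and types $T(a),T'(a)$ at positions $a$), and let $P_*$ be a finite derivation with $P_*\le P$ and support $A_*$. Assume that for all $a\in A_*$: $a\in\mathrm{supp}(P')$, $t(\overline a)=t'(\overline a)$, $C(a)=C'(a)$ and $T(a)=T'(a)$. Let $P_*'$ be the derivation obtained from $P_*$ by replacing $t$ with $t'$ (same support, contexts and types as $P_*$, the judgment at $a$ having subject $t'|_{\overline a}$). Then $P_*'\le P'$.
   Context: Sequences: $\mathbb{N}^*$ finite sequences of naturals, $\varepsilon$ empty, $\cdot$ concatenation; the collapse $\overline a$ replaces each entry $\ge2$ of $a$ by $2$. Terms: $\Lambda^{111}$ = possibly infinite $\lambda$-terms $t,u::=x\mid\lambda x.t\mid tu$ (coinductive, up to $\alpha$-equivalence), identified with parsing trees: $\mathrm{supp}(x)=\{\varepsilon\}$, $\mathrm{supp}(\lambda x.t)=\{\varepsilon\}\cup0\cdot\mathrm{supp}(t)$, $\mathrm{supp}(tu)=\{\varepsilon\}\cup1\cdot\mathrm{supp}(t)\cup2\cdot\mathrm{supp}(u)$, labels $x,\lambda x,@$ at the root; $t(p)$ label and $t|_p$ subterm at $p$. $\Lambda^{001}$: terms every infinite branch of whose support has infinitely many entries $2$. Types: mutually coinductive $T::=\alpha\mid F\to T$, $F::=(T_k)_{k\in K}$, $K\subseteq\mathbb{N}\setminus\{0,1\}$, syntactic equality; $\mathrm{supp}(\alpha)=\{\varepsilon\}$, $\mathrm{supp}(F\to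 T)=\{\varepsilon\}\cup\mathrm{supp}(F)\cup1\cdot\mathrm{supp}(T)$, $\mathrm{supp}((T_k)_k)=\bigcup_kk\cdot\mathrm{supp}(T_k)$, positions labelled by $\to$ or type variables, no infinite branch ending in $1^\omega$. $()$ empty sequence type; $k\cdot T$ single component $T$ at index $k$; disjoint sequence types have a join collecting all components. Contexts map variables to sequence types; $C-x$ resets $x$ to $()$; joins pointwise. Derivations: possibly infinite trees of judgments $C\vdash t:T$ generated coinductively by (ax) $x:k\cdot T\vdash x:T$, $k\ge2$; (abs) from $C\vdash t:T$ infer $C-x\vdash\lambda x.t:C(x)\to T$; (app) from $C\vdash t:(S_k)_{k\in K}\to T$ and for each $k\in K$ a premise $D_k\vdash u:S_k$, infer $C\cup\bigcup_kD_k\vdash tu:T$, with $C$ and the $D_k$ pairwise disjoint. Support: $\{\varepsilon\}$ for an axiom, $\{\varepsilon\}\cup0\cdot\mathrm{supp}(P_0)$ for (abs), $\{\varepsilon\}\cup1\cdot\mathrm{supp}(P_1)\cup\bigcup_kk\cdot\mathrm{supp}(P_k)$ for (app); judgment at $a$ is $C(a)\vdash t|_{\overline a}:T(a)$. Bipositions: $(a,c)$ with $c\in\mathrm{supp}(T(a))$ and $(a,x,c)$ with $c\in\mathrm{supp}(C(a)(x))$; $\mathrm{bisupp}(P)$ their set, $P(\mathtt b)$ the label. $P$ finite if $\mathrm{bisupp}(P)$ finite. For derivations $P_*,P$ typing the same term, $P_*\le P$ means $P_*$ is finite, $\mathrm{bisupp}(P_*)\subseteq\mathrm{bisupp}(P)$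 and $P_*(\mathtt b)=P(\mathtt b)$ on $\mathrm{bisupp}(P_*)$. -}

module Defs where

open import Data.Nat using (ℕ; zero; suc; _≤_; _≡ᵇ_)
open import Data.Bool using (if_then_else_)
open import Data.List using (List; []; _∷_; _∷ʳ_; _++_; replicate; map)
open import Data.List.Membership.Propositional using (_∈_)
open import Data.Maybe using (Maybe; just; nothing)
open import Data.Product using (Σ; ∃; _×_)
open import Data.Sum using (_⊎_)
open import Data.Empty using (⊥)
open import Relation.Nullary using (¬_)
open import Relation.Binary.PropositionalEquality using (_≡_; _≢_)

-- Positions (finite sequences of naturals), child = append at the end

Pos : Set
Pos = List ℕ

Var : Set
Var = ℕ

col : ℕ → ℕ
col zero = zero
col (suc zero) = suc zero
col (suc (suc _)) = 2

collapse : Pos → Pos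
collapse = map col

Def : {A : Set} → Maybe A → Set
Def {A} m = Σ A λ v → m ≡ just v

-- Possibly infinite λ-terms as labelled parsing trees (Λ^111)

data TLabel : Set where
  var : Var → TLabel
  lam : Var → TLabel
  app : TLabel

AllowedChild : TLabel → ℕ → Set
AllowedChild (var _) i = ⊥
AllowedChild (lam _) i = i ≡ 0
AllowedChild app i = i ≡ 1 ⊎ i ≡ 2

record Term : Set where
  field
    lab      : Pos → Maybe TLabel      -- nothing = outside the support
    root     : Def (lab [])
    parent   : ∀ p i → Def (lab (p ∷ʳ i)) →
               Σ TLabel λ v → lab p ≡ just v × AllowedChild v i
    lamChild : ∀ p x → lab p ≡ just (lam x) → Def (lab (p ∷ʳ 0))
    appChild : ∀ p → lab p ≡ just app → Def (lab (p ∷ʳ 1)) × Def (lab (p ∷ʳ 2))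
open Term public

-- Types and sequence types as labelled trees (syntactic equality =
-- equality of supports and labels, i.e. pointwise equality of labellings)

data TyLabel : Set where
  arrow : TyLabel
  tvar  : ℕ → TyLabel

Lab : Set
Lab = Pos → Maybe TyLabel

record IsType (L : Lab) : Set where
  field
    root     : Def (L [])
    parent   : ∀ p i → Def (L (p ∷ʳ i)) → L p ≡ just arrow
    noZero   : ∀ p → L (p ∷ʳ 0) ≡ nothing
    codomain : ∀ p → L p ≡ just arrow → Def (L (p ∷ʳ 1))
    no1ω     : ¬ (Σ Pos λ c → ∀ n → Def (L (c ++ replicate n 1)))

-- sequence types (T_k)_{k ∈ K}, K ⊆ ℕ ∖ {0,1}; supp = ⋃ k·supp(T_k)
record IsSeqType (F : Lab) : Set where
  field
    noRoot : F [] ≡ nothing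
    no0    : ∀ c → F (0 ∷ c) ≡ nothing
    no1    : ∀ c → F (1 ∷ c) ≡ nothing
    absent : ∀ k → F (k ∷ []) ≡ nothing → ∀ c → F (k ∷ c) ≡ nothing
    comp   : ∀ k → Def (F (k ∷ [])) → IsType (λ c → F (k ∷ c))

single : ℕ → Lab → Lab
single k T [] = nothing
single k T (k' ∷ c) = if k' ≡ᵇ k then T c else nothing

arrowTy : Lab → Lab → Lab
arrowTy F T [] = just arrow
arrowTy F T (1 ∷ c) = T c
arrowTy F T (k ∷ c) = F (k ∷ c)

Ctx : Set
Ctx = Var → Lab

reset : Ctx → Var → Ctx
reset C x y = if y ≡ᵇ x then (λ _ → nothing) else C y

-- Derivations, presented by their support and the contexts/types at
-- each position (the judgment at a is  ctx a ⊢ t|_{collapse a} : ty a)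

record Deriv : Set₁ where
  field
    supp : Pos → Set
    ctx  : Pos → Ctx
    ty   : Pos → Lab
open Deriv public

module _ (t : Term) (P : Deriv) where

  AxRule : Pos → Var → Set
  AxRule a x =
    (∀ i → ¬ supp P (a ∷ʳ i)) ×
    (Σ ℕ λ k → 2 ≤ k × (∀ c → ctx P a x c ≡ single k (ty P a) c)) ×
    (∀ y → y ≢ x → ∀ c → ctx P a y c ≡ nothing)

  AbsRule : Pos → Var → Set
  AbsRule a x =
    supp P (a ∷ʳ 0) ×
    (∀ i → i ≢ 0 → ¬ supp P (a ∷ʳ i)) ×
    (∀ y c → ctx P a y c ≡ reset (ctx P (a ∷ʳ 0)) x y c) ×
    (∀ c → ty P a c ≡ arrowTy (ctx P (a ∷ʳ 0) x) (ty P (a ∷ʳ 0)) c)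

  AppRule : Pos → Set
  AppRule a =
    supp P (a ∷ʳ 1) ×
    ¬ supp P (a ∷ʳ 0) ×
    -- T(a·1) = (S_k)_{k∈K} → T(a)
    ty P (a ∷ʳ 1) [] ≡ just arrow ×
    (∀ c → ty P (a ∷ʳ 1) (1 ∷ c) ≡ ty P a c) ×
    -- premises exactly at a·k, k ∈ K, typed by S_k
    (∀ k → 2 ≤ k → supp P (a ∷ʳ k) → Def (ty P (a ∷ʳ 1) (k ∷ []))) ×
    (∀ k → 2 ≤ k → Def (ty P (a ∷ʳ 1) (k ∷ [])) → supp P (a ∷ʳ k)) ×
    (∀ k c → 2 ≤ k → supp P (a ∷ʳ k) → ty P (a ∷ʳ k) c ≡ ty P (a ∷ʳ 1) (k ∷ c)) ×
    (∀ x j j' m → j ≢ j' → supp P (a ∷ʳ j) → supp P (a ∷ʳ j') →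
       ¬ (Def (ctx P (a ∷ʳ j) x (m ∷ [])) × Def (ctx P (a ∷ʳ j') x (m ∷ [])))) ×
    (∀ x c j → supp P (a ∷ʳ j) → Def (ctx P (a ∷ʳ j) x c) →
       ctx P a x c ≡ ctx P (a ∷ʳ j) x c) ×
    (∀ x c v → ctx P a x c ≡ just v →
       Σ ℕ λ j → supp P (a ∷ʳ j) × ctx P (a ∷ʳ j) x c ≡ just v)

  RuleAt : Pos → Maybe TLabel → Set
  RuleAt a nothing = ⊥
  RuleAt a (just (var x)) = AxRule a x
  RuleAt a (just (lam x)) = AbsRule a x
  RuleAt a (just app) = AppRule a

  record IsDeriv : Set where
    field
      root    : supp P []
      prefix  : ∀ a i → supp P (a ∷ʳ i) → supp P a
      types   : ∀ a → supp P a → IsType (ty P a)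
      ctxs    : ∀ a → supp P a → ∀ x → IsSeqType (ctx P a x)
      rules   : ∀ a → supp P a → RuleAt a (lab t (collapse a))

data BiPos : Set where
  tpos : Pos → Pos → BiPos
  cpos : Pos → Var → Pos → BiPos

bilabel : Deriv → BiPos → Maybe TyLabel
bilabel P (tpos a c) = ty P a c
bilabel P (cpos a x c) = ctx P a x c

Bisupp : Deriv → BiPos → Set
Bisupp P (tpos a c) = supp P a × Def (ty P a c)
Bisupp P (cpos a x c) = supp P a × Def (ctx P a x c)

Finite : Deriv → Set
Finite P = Σ (List BiPos) λ l → ∀ b → Bisupp P b → b ∈ l

-- P* ≤ P (both derivations typing the same term is stated separately)
_≤D_ : Deriv → Deriv → Set
P* ≤D P = Finite P* ×
          (∀ b → Bisupp P* b → Bisupp P b) ×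
          (∀ b → Bisupp P* b → bilabel P* b ≡ bilabel P b)

module Submission where

open import Defs
open import Data.Product using (_×_; _,_; proj₁; proj₂)
open import Relation.Binary.PropositionalEquality using (_≡_; sym; trans; subst)

-- Which rule applies at a depends on t only through its label at collapse a.
IsDeriv-retype : ∀ {t t' P} → IsDeriv t P →
                 (∀ a → supp P a → lab t (collapse a) ≡ lab t' (collapse a)) →
                 IsDeriv t' P
IsDeriv-retype {t' = t'} {P} dP same = record
  { root   = IsDeriv.root dP
  ; prefix = IsDeriv.prefix dP
  ; types  = IsDeriv.types dP
  ; ctxs   = IsDeriv.ctxs dP
  ; rules  = λ a s → subst (RuleAt t' P a) (same a s) (IsDeriv.rules dP a s)
  }

position : BiPos → Pos
position (tpos a _)   = a
position (cpos a _ _) = a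

Bisupp⇒supp : ∀ P b → Bisupp P b → supp P (position b)
Bisupp⇒supp P (tpos a c)   (s , _) = s
Bisupp⇒supp P (cpos a x c) (s , _) = s

JudgmentAgrees : Deriv → Deriv → Pos → Set
JudgmentAgrees P P' a =
  supp P' a × (∀ x c → ctx P a x c ≡ ctx P' a x c) × (∀ c → ty P a c ≡ ty P' a c)

module _ {P P' : Deriv} where

  bilabel-agrees : ∀ b → JudgmentAgrees P P' (position b) → bilabel P b ≡ bilabel P' b
  bilabel-agrees (tpos a c)   (_ , _ , tyEq)  = tyEq c
  bilabel-agrees (cpos a x c) (_ , ctxEq , _) = ctxEq x c

  Bisupp-agrees : ∀ b → JudgmentAgrees P P' (position b) → Bisupp P b → Bisupp P' b
  Bisupp-agrees (tpos a c) agree@(s' , _) (_ , v , e) =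
    s' , v , trans (sym (bilabel-agrees (tpos a c) agree)) e
  Bisupp-agrees (cpos a x c) agree@(s' , _) (_ , v , e) =
    s' , v , trans (sym (bilabel-agrees (cpos a x c) agree)) e

≤D-transfer : ∀ {P* P P'} → P* ≤D P →
              (∀ a → supp P* a → JudgmentAgrees P P' a) → P* ≤D P'
≤D-transfer {P*} {P} {P'} (fin , sub , eq) agree = fin , sub' , eq'
  where
  agreeAt : ∀ b → Bisupp P* b → JudgmentAgrees P P' (position b)
  agreeAt b bs = agree (position b) (Bisupp⇒supp P* b bs)

  sub' : ∀ b → Bisupp P* b → Bisupp P' b
  sub' b bs = Bisupp-agrees b (agreeAt b bs) (sub b bs)

  eq' : ∀ b → Bisupp P* b → bilabel P* b ≡ bilabel P' b
  eq' b bs = trans (eq b bs) (bilabel-agrees b (agreeAt b bs))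

lemma2 : (t t' : Term) (P P' P* : Deriv) →
         IsDeriv t P → IsDeriv t' P' → IsDeriv t P* → P* ≤D P →
         (∀ a → supp P* a →
            supp P' a ×
            lab t (collapse a) ≡ lab t' (collapse a) ×
            (∀ x c → ctx P a x c ≡ ctx P' a x c) ×
            (∀ c → ty P a c ≡ ty P' a c)) →
         IsDeriv t' P* × P* ≤D P'
lemma2 t t' P P' P* _ _ dP* P*≤P H =
  IsDeriv-retype dP* (λ a s → proj₁ (proj₂ (H a s))) ,
  ≤D-transfer P*≤P (λ a s → let (s' , _ , ctxEq , tyEq) = H a s in s' , ctxEq , tyEq)
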